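{- Let $\lambda=(\lambda_1,\lambda_2,\ldots)$ be a partition, viewed as an eventually-zero weakly decreasing sequence of nonnegative integers, whose $j$th part is playable, let $\lambda'=R_j(\lambda)$, and let $\mu=\mu_\lambda$, $\mu'=\mu_{\lambda'}$. Then: (1) If $j=1$, then $\mu'_i=\mu_{i+1}$ for $i\neq\lambda_1$ and $\mu'_{\lambda_1}=\mu_{\lambda_1+1}+1$. (2) If $j\geq 2$ and $\lambda_j\neq j-1$, then $\mu'_i=\mu_i$ for $i<j-1$; $\mu'_{j-1}=\mu_{j-1}+\mu_j$; $\mu'_i=\mu_{i+1}$ for $i\geq j$, $i\neq\lambda_j$; and $\mu'_{\lambda_j}=\mu_{\lambda_j+1}+1$. (3) If $j\geq 2$ and $\lambda_j=j-1$, then $\mu'_i=\mu_i$ for $i<j-1$; $\mu'_{j-1}=\mu_{j-1}+\mu_j+1$; and $\mu'_i=\mu_{i+1}$ for $i\geq j$. Moreover, the bars of $\mu'$ are as follows: for $i\leq j-1$, position $i$ is barred iff $\mu'_i\neq 0$; for $i\geq j$, position $i$ is barred iff $\mu'_i\neq 0$ and $\sum_{k=j}^{i}\mu_k<3$.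
   Context: A partition $\lambda$ with $\ell(\lambda)$ nonzero parts is written as an infinite sequence $(\lambda_1,\lambda_2,\ldots)$, eventually $0$. Its $j$th part is playable if $\lambda_j\geq \ell(\lambda)-1$; in that case the reversed Bulgarian Solitaire move $R_j$ removes the $j$th row of the Young diagram of $\lambda$ and inserts it as a new leftmost column (equivalently, removes the $j$th part and distributes its $\lambda_j$ units one to each of the other parts, including new parts where there were zeros). The representation $\mu_\lambda=(\mu_1,\mu_2,\ldots)$ is defined by $\mu_i=\lambda_i-\lambda_{i+1}$, and position $j$ of $\mu_\lambda$ is barred iff the $j$th part of $\lambda$ is playable and $\mu_j\neq 0$. -}

module Defs where

open import Data.Nat using (ℕ; zero; suc; _+_; _∸_; _≤_; _<_; _<ᵇ_; _≤ᵇ_)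
open import Data.Bool using (if_then_else_)
open import Data.Product using (Σ; _×_)
open import Relation.Binary.PropositionalEquality using (_≡_; _≢_)

-- A sequence (λ₁, λ₂, …) is represented by a function ℕ → ℕ; position i ≥ 1
-- is the value at i (the value at 0 is ignored everywhere).

IsPartition : (ℕ → ℕ) → Set
IsPartition p =
  (∀ i → 1 ≤ i → p (suc i) ≤ p i) × Σ ℕ (λ N → ∀ i → N < i → p i ≡ 0)

HasLength : (ℕ → ℕ) → ℕ → Set
HasLength p ℓ = (∀ i → 1 ≤ i → i ≤ ℓ → p i ≢ 0) × (∀ i → ℓ < i → p i ≡ 0)

Playable : (ℕ → ℕ) → ℕ → Set
Playable p j = Σ ℕ (λ ℓ → HasLength p ℓ × ℓ ≤ suc (p j))

removePart : ℕ → (ℕ → ℕ) → ℕ → ℕ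
removePart j p i = if i <ᵇ j then p i else p (suc i)

-- R_j : remove the j-th row and insert it as a new leftmost column
--       (add 1 to each of the first λ_j parts of the remaining sequence)
R : ℕ → (ℕ → ℕ) → ℕ → ℕ
R j p i = if i ≤ᵇ p j then suc (removePart j p i) else removePart j p i

mu : (ℕ → ℕ) → ℕ → ℕ
mu p i = p i ∸ p (suc i)

Barred : (ℕ → ℕ) → ℕ → Set
Barred p i = Playable p i × mu p i ≢ 0

sumFrom : (ℕ → ℕ) → ℕ → ℕ → ℕ
sumFrom f a zero = 0
sumFrom f a (suc n) = f a + sumFrom f (suc a) n

-- Σ_{k=a}^{b} f k  (empty if b < a)
sumFromTo : (ℕ → ℕ) → ℕ → ℕ → ℕ
sumFromTo f a b = sumFrom f a (suc b ∸ a)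

{-# OPTIONS --safe #-}
-- The move factors as R j p = addColumn (p j) (removePart j p). Deleting the
-- j-th part merges μ_{j-1} and μ_j into one difference and shifts every later
-- μ_i down by one place; adding a column of height h then raises μ_h alone by
-- one. For the bars: when λ_j ≠ 0 the new partition has exactly λ_j parts, so
-- its i-th part is playable iff λ_j ≤ λ'_i + 1. Below j this always holds;
-- from j on λ'_i = λ_{i+1} + 1, and λ_j − λ_{i+1} telescopes to Σ_{k=j}^{i} μ_k.
-- When λ_j = 0 all parts from j on vanish, the move changes nothing and every
-- part is playable.
module Submission where

open import Defs
open import Data.Nat using (ℕ; zero; suc; _+_; _∸_; _≤_; _<_; z≤n; s≤s; s≤s⁻¹; z<s; _≤′_; ≤′-refl; ≤′-step; _≤ᵇ_; _<ᵇ_; _≟_; _≤?_; _<?_)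
open import Data.Nat.Properties
open import Data.Bool using (true; false; T; if_then_else_)
open import Data.Product using (_×_; _,_; proj₂)
open import Function.Bundles using (_⇔_; mk⇔; Equivalence)
open import Function.Properties.Equivalence using () renaming (trans to ⇔-trans; sym to ⇔-sym)
open import Relation.Binary.PropositionalEquality
open import Relation.Binary.Definitions using (tri<; tri≈; tri>)
open import Relation.Nullary using (contradiction; yes; no)

Decreasing : (ℕ → ℕ) → Set
Decreasing p = ∀ i → 1 ≤ i → p (suc i) ≤ p i

decreasing⇒antitone : ∀ {p} → Decreasing p → ∀ {a b} → 1 ≤ a → a ≤ b → p b ≤ p a
decreasing⇒antitone {p} decr {a} 1≤a a≤b = go (≤⇒≤′ a≤b)
  where
  go : ∀ {b} → a ≤′ b → p b ≤ p a
  go ≤′-refl = ≤-refl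
  go (≤′-step a≤′b) = ≤-trans (decr _ (≤-trans 1≤a (≤′⇒≤ a≤′b))) (go a≤′b)

∸-split : ∀ {a b c} → c ≤ b → b ≤ a → a ∸ c ≡ a ∸ b + (b ∸ c)
∸-split {a} {b} {c} c≤b b≤a = begin
  a ∸ c            ≡⟨ cong (_∸ c) (m∸n+n≡m b≤a) ⟨
  (a ∸ b + b) ∸ c  ≡⟨ +-∸-assoc (a ∸ b) c≤b ⟩
  a ∸ b + (b ∸ c)  ∎
  where open ≡-Reasoning

m∸n<1+o⇔m≤o+n : ∀ m n o → m ∸ n < suc o ⇔ m ≤ o + n
m∸n<1+o⇔m≤o+n m n o = mk⇔
  (λ m∸n<1+o → ≤-trans (m≤n+m∸n m n)
                 (≤-trans (+-monoʳ-≤ n (s≤s⁻¹ m∸n<1+o)) (≤-reflexive (+-comm n o))))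
  (λ m≤o+n → s≤s (m≤n+o⇒m∸n≤o m n (≤-trans m≤o+n (≤-reflexive (+-comm o n)))))

sumFrom-mu : ∀ {p} → Decreasing p → ∀ {a} → 1 ≤ a → ∀ n → sumFrom (mu p) a n ≡ p a ∸ p (a + n)
sumFrom-mu {p} decr {a} 1≤a zero = begin
  0              ≡⟨ n∸n≡0 (p a) ⟨
  p a ∸ p a      ≡⟨ cong (λ x → p a ∸ p x) (+-identityʳ a) ⟨
  p a ∸ p (a + 0) ∎
  where open ≡-Reasoning
sumFrom-mu {p} decr {a} 1≤a (suc n) = begin
  mu p a + sumFrom (mu p) (suc a) n   ≡⟨ cong (mu p a +_) (sumFrom-mu decr (m≤n⇒m≤1+n 1≤a) n) ⟩
  mu p a + (p (suc a) ∸ p (suc a + n)) ≡⟨ ∸-split tail≤ (decr a 1≤a) ⟨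
  p a ∸ p (suc a + n)                 ≡⟨ cong (λ x → p a ∸ p x) (+-suc a n) ⟨
  p a ∸ p (a + suc n)                 ∎
  where
  open ≡-Reasoning
  tail≤ : p (suc a + n) ≤ p (suc a)
  tail≤ = decreasing⇒antitone decr (m≤n⇒m≤1+n 1≤a) (m≤m+n (suc a) n)

sumFromTo-mu : ∀ {p} → Decreasing p → ∀ {a b} → 1 ≤ a → a ≤ suc b →
               sumFromTo (mu p) a b ≡ p a ∸ p (suc b)
sumFromTo-mu {p} decr {a} {b} 1≤a a≤1+b =
  trans (sumFrom-mu decr 1≤a (suc b ∸ a)) (cong (λ x → p a ∸ p x) (m+[n∸m]≡n a≤1+b))

hasLength-unique : ∀ {f a b} → HasLength f a → HasLength f b → a ≡ b
hasLength-unique {a = a} {b} (nz-a , z-a) (nz-b , z-b) with <-cmp a b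
... | tri< a<b _ _ = contradiction (z-a b a<b) (nz-b b (≤-trans (s≤s z≤n) a<b) ≤-refl)
... | tri≈ _ a≡b _ = a≡b
... | tri> _ _ b<a = contradiction (z-b a b<a) (nz-a a (≤-trans (s≤s z≤n) b<a) ≤-refl)

hasLength-cong : ∀ {f g L} → (∀ i → 1 ≤ i → f i ≡ g i) → HasLength f L → HasLength g L
hasLength-cong f≗g (nz , z) =
  (λ i 1≤i i≤L → subst (_≢ 0) (f≗g i 1≤i) (nz i 1≤i i≤L)) ,
  (λ i L<i → trans (sym (f≗g i (≤-trans (s≤s z≤n) L<i))) (z i L<i))

positive⇒≤length : ∀ {f L i} → HasLength f L → 1 ≤ f i → i ≤ L
positive⇒≤length {i = i} (_ , z) 1≤fi = ≮⇒≥ λ L<i → n≮0 (subst (1 ≤_) (z i L<i) 1≤fi)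

mu-beyond-length : ∀ {f L i} → HasLength f L → L < i → mu f i ≡ 0
mu-beyond-length {f} {i = i} (_ , z) L<i = trans (cong (_∸ f (suc i)) (z i L<i)) (0∸n≡0 (f (suc i)))

playable⇔ : ∀ {f L i} → HasLength f L → Playable f i ⇔ L ≤ suc (f i)
playable⇔ {f} {i = i} len = mk⇔
  (λ (L′ , len′ , L′≤) → subst (_≤ suc (f i)) (hasLength-unique len′ len) L′≤)
  (λ L≤ → _ , len , L≤)

module _ {j : ℕ} {p : ℕ → ℕ} where

  removePart-before : ∀ {i} → i < j → removePart j p i ≡ p i
  removePart-before {i} i<j with i <ᵇ j in eq
  ... | true  = refl
  ... | false = contradiction (subst T eq (<⇒<ᵇ i<j)) λ ()

  removePart-from : ∀ {i} → j ≤ i → removePart j p i ≡ p (suc i)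
  removePart-from {i} j≤i with i <ᵇ j in eq
  ... | true  = contradiction (<ᵇ⇒< i j (subst T (sym eq) _)) (≤⇒≯ j≤i)
  ... | false = refl

  removePart≤part : Decreasing p → ∀ {i} → 1 ≤ i → removePart j p i ≤ p i
  removePart≤part decr {i} 1≤i with i <ᵇ j
  ... | true  = ≤-refl
  ... | false = decr i 1≤i

  nextPart≤removePart : Decreasing p → ∀ {i} → 1 ≤ i → p (suc i) ≤ removePart j p i
  nextPart≤removePart decr {i} 1≤i with i <ᵇ j
  ... | true  = decr i 1≤i
  ... | false = ≤-refl

  removePart-decreasing : Decreasing p → Decreasing (removePart j p)
  removePart-decreasing decr i 1≤i =
    ≤-trans (removePart≤part decr (m≤n⇒m≤1+n 1≤i)) (nextPart≤removePart decr 1≤i)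

  removePart-beyond-length : ∀ {ℓ i} → HasLength p ℓ → j ≤ ℓ → ℓ ≤ i → removePart j p i ≡ 0
  removePart-beyond-length {i = i} (_ , z) j≤ℓ ℓ≤i =
    trans (removePart-from (≤-trans j≤ℓ ℓ≤i)) (z (suc i) (s≤s ℓ≤i))

  mu-removePart-before : ∀ {i} → suc i < j → mu (removePart j p) i ≡ mu p i
  mu-removePart-before {i} 1+i<j =
    cong₂ _∸_ (removePart-before (<-trans (n<1+n i) 1+i<j)) (removePart-before 1+i<j)

  mu-removePart-from : ∀ {i} → j ≤ i → mu (removePart j p) i ≡ mu p (suc i)
  mu-removePart-from {i} j≤i = cong₂ _∸_ (removePart-from j≤i) (removePart-from (m≤n⇒m≤1+n j≤i))

mu-removePart-merge : ∀ {p} → Decreasing p → ∀ {k} → 1 ≤ k →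
                      mu (removePart (suc k) p) k ≡ mu p k + mu p (suc k)
mu-removePart-merge {p} decr {k} 1≤k = begin
  mu (removePart (suc k) p) k
    ≡⟨ cong₂ _∸_ (removePart-before {p = p} (n<1+n k)) (removePart-from {p = p} (n<1+n k)) ⟩
  p k ∸ p (suc (suc k))        ≡⟨ ∸-split (decr (suc k) (m≤n⇒m≤1+n 1≤k)) (decr k 1≤k) ⟩
  mu p k + mu p (suc k)        ∎
  where open ≡-Reasoning

addColumn : ℕ → (ℕ → ℕ) → ℕ → ℕ
addColumn h q i = if i ≤ᵇ h then suc (q i) else q i

module _ {h : ℕ} {q : ℕ → ℕ} where

  addColumn-within : ∀ {i} → i ≤ h → addColumn h q i ≡ suc (q i)
  addColumn-within {i} i≤h with i ≤ᵇ h in eq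
  ... | true  = refl
  ... | false = contradiction (subst T eq (≤⇒≤ᵇ i≤h)) λ ()

  addColumn-beyond : ∀ {i} → h < i → addColumn h q i ≡ q i
  addColumn-beyond {i} h<i with i ≤ᵇ h in eq
  ... | true  = contradiction (≤ᵇ⇒≤ i h (subst T (sym eq) _)) (<⇒≱ h<i)
  ... | false = refl

  part≤addColumn : ∀ {i} → q i ≤ addColumn h q i
  part≤addColumn {i} with i ≤ᵇ h
  ... | true  = n≤1+n (q i)
  ... | false = ≤-refl

  mu-addColumn-≢ : ∀ {i} → i ≢ h → mu (addColumn h q) i ≡ mu q i
  mu-addColumn-≢ {i} i≢h with <-cmp i h
  ... | tri< i<h _ _ = cong₂ _∸_ (addColumn-within (<⇒≤ i<h)) (addColumn-within i<h)
  ... | tri≈ _ i≡h _ = contradiction i≡h i≢h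
  ... | tri> _ _ h<i = cong₂ _∸_ (addColumn-beyond h<i) (addColumn-beyond (m≤n⇒m≤1+n h<i))

  mu-addColumn-height : q (suc h) ≤ q h → mu (addColumn h q) h ≡ mu q h + 1
  mu-addColumn-height q₁≤q₀ = begin
    addColumn h q h ∸ addColumn h q (suc h)
      ≡⟨ cong₂ _∸_ (addColumn-within ≤-refl) (addColumn-beyond ≤-refl) ⟩
    suc (q h) ∸ q (suc h)                    ≡⟨ +-∸-assoc 1 q₁≤q₀ ⟩
    1 + mu q h                               ≡⟨ +-comm 1 (mu q h) ⟩
    mu q h + 1                               ∎
    where open ≡-Reasoning

  addColumn-hasLength : (∀ i → h < i → q i ≡ 0) → HasLength (addColumn h q) h
  addColumn-hasLength vanish =
    (λ i _ i≤h → subst (_≢ 0) (sym (addColumn-within i≤h)) λ ()) ,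
    (λ i h<i → trans (addColumn-beyond h<i) (vanish i h<i))

-- The move is studied at j = suc k, so that the paper's j − 1 is k. R j p
-- unfolds definitionally to addColumn (p j) q, so the addColumn lemmas apply.
module Move {p : ℕ → ℕ} (decr : Decreasing p) {ℓ : ℕ} (len : HasLength p ℓ)
            (k : ℕ) (playable : ℓ ≤ suc (p (suc k))) where

  j : ℕ
  j = suc k

  q : ℕ → ℕ
  q = removePart j p

  mu-R-≢ : ∀ {i} → i ≢ p j → mu (R j p) i ≡ mu q i
  mu-R-≢ = mu-addColumn-≢ {q = q}

  mu-R-height : 1 ≤ p j → mu (R j p) (p j) ≡ mu q (p j) + 1
  mu-R-height 1≤pj = mu-addColumn-height {q = q} (removePart-decreasing {j = j} decr (p j) 1≤pj)

  mu-R-below : ∀ {i} → 1 ≤ i → i < k → mu (R j p) i ≡ mu p i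
  mu-R-below {i} 1≤i i<k = trans (mu-R-≢ i≢pj) (mu-removePart-before {p = p} (s≤s i<k))
    where
    i≢pj : i ≢ p j
    i≢pj i≡pj = <⇒≢ 1≤i (sym (trans i≡pj (proj₂ len j (s≤s ℓ≤k))))
      where
      ℓ≤k : ℓ ≤ k
      ℓ≤k = ≤-trans playable (≤-trans (s≤s (≤-reflexive (sym i≡pj))) i<k)

  mu-R-above : ∀ {i} → j ≤ i → i ≢ p j → mu (R j p) i ≡ mu p (suc i)
  mu-R-above j≤i i≢pj = trans (mu-R-≢ i≢pj) (mu-removePart-from {p = p} j≤i)

  mu-R-height-above : 1 ≤ p j → j ≤ p j → mu (R j p) (p j) ≡ mu p (suc (p j)) + 1
  mu-R-height-above 1≤pj j≤pj = trans (mu-R-height 1≤pj) (cong (_+ 1) (mu-removePart-from {p = p} j≤pj))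

  j≤height : 1 ≤ p j → p j ≢ k → j ≤ p j
  j≤height 1≤pj pj≢k =
    ≤∧≢⇒< (s≤s⁻¹ (≤-trans (positive⇒≤length len 1≤pj) playable)) (λ k≡pj → pj≢k (sym k≡pj))

  mu-R-merge : 1 ≤ k → p j ≢ k → mu (R j p) k ≡ mu p k + mu p j
  mu-R-merge 1≤k pj≢k = trans (mu-R-≢ (λ k≡pj → pj≢k (sym k≡pj))) (mu-removePart-merge decr 1≤k)

  mu-R-merge-height : 1 ≤ k → p j ≡ k → mu (R j p) k ≡ mu p k + mu p j + 1
  mu-R-merge-height 1≤k pj≡k = begin
    mu (R j p) k      ≡⟨ cong (mu (R j p)) pj≡k ⟨
    mu (R j p) (p j)  ≡⟨ mu-R-height (subst (1 ≤_) (sym pj≡k) 1≤k) ⟩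
    mu q (p j) + 1    ≡⟨ cong (λ x → mu q x + 1) pj≡k ⟩
    mu q k + 1        ≡⟨ cong (_+ 1) (mu-removePart-merge decr 1≤k) ⟩
    mu p k + mu p j + 1 ∎
    where open ≡-Reasoning

  parts-vanish-from : p j ≡ 0 → ∀ {i} → j ≤ i → p i ≡ 0
  parts-vanish-from pj≡0 {i} j≤i =
    n≤0⇒n≡0 (subst (p i ≤_) pj≡0 (decreasing⇒antitone decr (s≤s z≤n) j≤i))

  R-zero-part : p j ≡ 0 → ∀ i → 1 ≤ i → R j p i ≡ p i
  R-zero-part pj≡0 i 1≤i = trans (addColumn-beyond {q = q} (subst (_< i) (sym pj≡0) 1≤i)) q≡p
    where
    q≡p : q i ≡ p i
    q≡p with i <? j
    ... | yes i<j = removePart-before {p = p} i<j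
    ... | no i≮j  = trans (removePart-from {p = p} (≮⇒≥ i≮j))
                      (trans (parts-vanish-from pj≡0 (m≤n⇒m≤1+n (≮⇒≥ i≮j)))
                             (sym (parts-vanish-from pj≡0 (≮⇒≥ i≮j))))

  playable-R-zero : p j ≡ 0 → ∀ i → Playable (R j p) i
  playable-R-zero pj≡0 i =
    ℓ , hasLength-cong (λ i 1≤i → sym (R-zero-part pj≡0 i 1≤i)) len ,
    ≤-trans (subst (λ x → ℓ ≤ suc x) pj≡0 playable) (s≤s z≤n)

  R-hasLength : 1 ≤ p j → HasLength (R j p) (p j)
  R-hasLength 1≤pj = addColumn-hasLength {q = q}
    λ i pj<i → removePart-beyond-length {j = j} len (positive⇒≤length len 1≤pj) (≤-trans playable pj<i)

  playable-R-below : ∀ {i} → 1 ≤ i → i < j → Playable (R j p) i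
  playable-R-below {i} 1≤i i<j with p j ≟ 0
  ... | yes pj≡0 = playable-R-zero pj≡0 i
  ... | no pj≢0  =
    Equivalence.from (playable⇔ {i = i} (R-hasLength (n≢0⇒n>0 pj≢0))) (m≤n⇒m≤1+n pj≤R)
    where
    pj≤R : p j ≤ R j p i
    pj≤R = begin
      p j               ≤⟨ decreasing⇒antitone decr 1≤i (<⇒≤ i<j) ⟩
      p i               ≡⟨ removePart-before {p = p} i<j ⟨
      q i               ≤⟨ part≤addColumn {h = p j} {q = q} {i} ⟩
      R j p i           ∎
      where open ≤-Reasoning

  barred-R-below : ∀ {i} → 1 ≤ i → i < j → Barred (R j p) i ⇔ mu (R j p) i ≢ 0
  barred-R-below 1≤i i<j = mk⇔ proj₂ (playable-R-below 1≤i i<j ,_)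

  sumFromTo-mu-from-j : ∀ {i} → j ≤ i → sumFromTo (mu p) j i ≡ p j ∸ p (suc i)
  sumFromTo-mu-from-j j≤i = sumFromTo-mu decr (s≤s z≤n) (m≤n⇒m≤1+n j≤i)

  playable-R-above⇔ : ∀ {i} → 1 ≤ p j → j ≤ i → i ≤ p j →
                      Playable (R j p) i ⇔ sumFromTo (mu p) j i < 3
  playable-R-above⇔ {i} 1≤pj j≤i i≤pj =
    ⇔-trans (playable⇔ {i = i} (R-hasLength 1≤pj))
      (subst₂ (λ x y → (p j ≤ suc x) ⇔ (y < 3)) (sym R≡) (sym (sumFromTo-mu-from-j j≤i))
        (⇔-sym (m∸n<1+o⇔m≤o+n (p j) (p (suc i)) 2)))
    where
    R≡ : R j p i ≡ suc (p (suc i))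
    R≡ = trans (addColumn-within {q = q} i≤pj) (cong suc (removePart-from {p = p} j≤i))

  barred-R-above : ∀ {i} → j ≤ i → Barred (R j p) i ⇔ (mu (R j p) i ≢ 0 × sumFromTo (mu p) j i < 3)
  barred-R-above {i} j≤i with p j ≟ 0
  ... | yes pj≡0 = mk⇔ (λ (_ , mu≢0) → mu≢0 , sum<3) (λ (mu≢0 , _) → playable-R-zero pj≡0 i , mu≢0)
    where
    sum<3 : sumFromTo (mu p) j i < 3
    sum<3 = ≤-<-trans (≤-trans (≤-reflexive (sumFromTo-mu-from-j j≤i))
                      (≤-trans (m∸n≤m (p j) (p (suc i))) (≤-reflexive pj≡0))) z<s
  ... | no pj≢0 with i ≤? p j
  ...   | yes i≤pj = mk⇔ (λ (pl , mu≢0) → mu≢0 , Equivalence.to pl⇔ pl)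
                         (λ (mu≢0 , sum<3) → Equivalence.from pl⇔ sum<3 , mu≢0)
    where pl⇔ = playable-R-above⇔ (n≢0⇒n>0 pj≢0) j≤i i≤pj
  ...   | no i≰pj  = mk⇔ (λ (_ , mu≢0) → contradiction mu≡0 mu≢0)
                         (λ (mu≢0 , _) → contradiction mu≡0 mu≢0)
    where mu≡0 = mu-beyond-length (R-hasLength (n≢0⇒n>0 pj≢0)) (≰⇒> i≰pj)

lemma2p4 : (p : ℕ → ℕ) (j : ℕ) → IsPartition p → 1 ≤ j → Playable p j →
    ((j ≡ 1 →
        (∀ i → 1 ≤ i → i ≢ p 1 → mu (R j p) i ≡ mu p (suc i))
        × (1 ≤ p 1 → mu (R j p) (p 1) ≡ mu p (suc (p 1)) + 1))
    × (2 ≤ j → p j ≢ j ∸ 1 →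
        (∀ i → 1 ≤ i → i < j ∸ 1 → mu (R j p) i ≡ mu p i)
        × (mu (R j p) (j ∸ 1) ≡ mu p (j ∸ 1) + mu p j)
        × (∀ i → j ≤ i → i ≢ p j → mu (R j p) i ≡ mu p (suc i))
        × (1 ≤ p j → mu (R j p) (p j) ≡ mu p (suc (p j)) + 1))
    × (2 ≤ j → p j ≡ j ∸ 1 →
        (∀ i → 1 ≤ i → i < j ∸ 1 → mu (R j p) i ≡ mu p i)
        × (mu (R j p) (j ∸ 1) ≡ mu p (j ∸ 1) + mu p j + 1)
        × (∀ i → j ≤ i → mu (R j p) i ≡ mu p (suc i))))
    × (∀ i → 1 ≤ i → i ≤ j ∸ 1 → (Barred (R j p) i ⇔ mu (R j p) i ≢ 0))
    × (∀ i → j ≤ i →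
        (Barred (R j p) i ⇔ (mu (R j p) i ≢ 0 × sumFromTo (mu p) j i < 3)))
lemma2p4 p (suc k) (decr , _) _ (ℓ , len , playable) =
  ( (λ { refl → (λ i → mu-R-above) , (λ 1≤p1 → mu-R-height-above 1≤p1 1≤p1) })
  , (λ 2≤j pj≢k → (λ i → mu-R-below) , mu-R-merge (s≤s⁻¹ 2≤j) pj≢k , (λ i → mu-R-above)
                  , λ 1≤pj → mu-R-height-above 1≤pj (j≤height 1≤pj pj≢k))
  , (λ 2≤j pj≡k → (λ i → mu-R-below) , mu-R-merge-height (s≤s⁻¹ 2≤j) pj≡k
                  , λ i j≤i → mu-R-above j≤i (λ i≡pj → <⇒≢ j≤i (sym (trans i≡pj pj≡k)))))
  , (λ i 1≤i i≤k → barred-R-below 1≤i (s≤s i≤k))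
  , (λ i → barred-R-above)
  where open Move decr len k playable
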